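{- Let $b=c_\ell\otimes\cdots\otimes c_1\in F(s)$ and write $b^*=d_1\otimes\cdots\otimes d_n$. (1) The cyclage is authorised for $b$ if and only if either (a) $|d_1|\ge\cdots\ge|d_n|$ and $\ell\notin d_1$, or (b) $b^*$ is Yamanouchi and $d_i\ne\{1,\dots,\ell\}$ for all $i=1,\dots,n$. (2) If some $k\in\{1,\dots,n\}$ belongs to every column $c_j$, then $\mathrm{red}(b)^*$ is obtained from $b^*$ by deleting its leftmost factor equal to $\{1,\dots,\ell\}$.
   Context: Fix integers $n,\ell\ge2$, $s\ge0$. $F(s)$: set of $b=c_\ell\otimes\cdots\otimes c_1$, $c_j\subseteq\{1,\dots,n\}$, $\sum|c_j|=s$. Duality: $b^*=d(1)\otimes\cdots\otimes d(n)$, $d(i)=\{j\in\{1,\dots,\ell\}:i\in c_j\}$. The word of $d_1\otimes\cdots\otimes d_n$ concatenates the entries of $d_1$ (increasing), then $d_2$, ..., $d_n$; it is Yamanouchi if every prefix contains at least as many letters $k$ as $k+1$ for all $k$. $b$ is a tableau if $c_1,\dots,c_\ell$ placed left to right, top-aligned, form a semistandard Young tableau. $b$ has dominant evaluation if for each $k=1,\dots,n-1$, the number of entries equal to $k+1$ in $b$ is at most the number of entries equal to $k$. The cyclage is authorised for $b$ if either (a) $b$ has dominant evaluation and $1\notin c_\ell$, or (b) $b$ is a tableau and no $k\in\{1,\dots,n\}$ belongs to every column $c_j$. If some $k$ belongs to every $c_j$, let $k_0$ be the least such; the reduction $\mathrm{red}(b)$ is obtained by deleting all occurrences of $k_0$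 in $b$ and replacing each entry $k>k_0$ by $k-1$ (an element with entries in $\{1,\dots,n-1\}$, whose dual has $n-1$ factors). -}

module Defs where

open import Data.Nat as ℕ using (ℕ; zero; suc; _≤_)
open import Data.Fin as Fin using (Fin; toℕ; punchIn)
open import Data.Fin.Subset as S using (Subset; _∈_; _∉_; ∣_∣)
open import Data.Fin.Subset.Properties using (_∈?_)
open import Data.List as L using (List; []; _∷_; _++_; filter; allFin; map; concat; length)
open import Data.Nat.ListAction using (sum)
open import Data.List.Relation.Unary.Linked using (Linked)
open import Data.Bool.Properties as BoolP using ()
open import Data.Vec.Properties using (≡-dec)
open import Data.Product using (_×_; ∃)
open import Data.Sum using (_⊎_)
open import Data.Unit using (⊤)
open import Data.Empty using (⊥)
open import Relation.Nullary using (¬_; Dec; yes; no)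
open import Relation.Binary.PropositionalEquality using (_≡_; _≢_)

-- An element b = c_ℓ ⊗ ⋯ ⊗ c_1 with c_j ⊆ {1,…,n} is encoded as a function
--   c : Fin ℓ → Subset n ,  c j = c_{toℕ j + 1},
-- where the element i : Fin n of Subset n stands for the integer toℕ i + 1.
Elt : ℕ → ℕ → Set
Elt n ℓ = Fin ℓ → Subset n

size : ∀ {n ℓ} → Elt n ℓ → ℕ
size {ℓ = ℓ} c = sum (map (λ j → ∣ c j ∣) (allFin ℓ))

InF : ∀ {n ℓ} → ℕ → Elt n ℓ → Set
InF s c = size c ≡ s

dualF : ∀ {n ℓ} → Elt n ℓ → Fin n → Subset ℓ
dualF c i = Data.Vec.tabulate (λ j → Data.Bool.Base.if Relation.Nullary.does (i ∈? c j) then S.inside else S.outside)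
  where import Data.Vec
        import Data.Bool.Base
        import Relation.Nullary

-- b* = d(1) ⊗ ⋯ ⊗ d(n), as the list [d(1), …, d(n)]
dual : ∀ {n ℓ} → Elt n ℓ → List (Subset ℓ)
dual {n} c = L.tabulate {n = n} (dualF c)

elems : ∀ {m} → Subset m → List (Fin m)
elems {m} p = filter (λ x → x ∈? p) (allFin m)

word : ∀ {ℓ} → List (Subset ℓ) → List ℕ
word ds = concat (map (λ d → map (λ j → suc (toℕ j)) (elems d)) ds)

countL : ℕ → List ℕ → ℕ
countL k w = length (filter (λ x → x ℕ.≟ k) w)

Yamanouchi : List ℕ → Set
Yamanouchi w = ∀ (p q : List ℕ) → w ≡ p ++ q →
  ∀ (k : ℕ) → 1 ≤ k → countL (suc k) p ≤ countL k p

entries : ∀ {n ℓ} → Elt n ℓ → Fin n → ℕ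
entries {ℓ = ℓ} c k = length (filter (λ j → k ∈? c j) (allFin ℓ))

DominantEval : ∀ {n ℓ} → Elt n ℓ → Set
DominantEval {n} c = ∀ (k k' : Fin n) → toℕ k' ≡ suc (toℕ k) → entries c k' ≤ entries c k

-- Row condition between two adjacent columns (left column xs, right column ys),
-- both listed top to bottom: right column not longer, rows weakly increasing.
RowOK : ∀ {m} → List (Fin m) → List (Fin m) → Set
RowOK xs       []       = ⊤
RowOK []       (y ∷ ys) = ⊥
RowOK (x ∷ xs) (y ∷ ys) = (x Fin.≤ y) × RowOK xs ys

-- b is a tableau: columns c_1, …, c_ℓ placed left to right, top-aligned, form
-- a semistandard Young tableau (columns strictly increase since they are sets).
IsTableau : ∀ {n ℓ} → Elt n ℓ → Set
IsTableau {ℓ = ℓ} c = ∀ (j j' : Fin ℓ) → toℕ j' ≡ suc (toℕ j) → RowOK (elems (c j)) (elems (c j'))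

InAllColumns : ∀ {n ℓ} → Elt n ℓ → Fin n → Set
InAllColumns c k = ∀ j → k ∈ c j

-- the cyclage is authorised for b (here n = suc m and ℓ = suc p, so that
-- Fin.zero represents 1 ∈ {1..n} and Fin.fromℕ p is the column index ℓ)
Authorised : ∀ {m p} → Elt (suc m) (suc p) → Set
Authorised {m} {p} c =
  (DominantEval c × Fin.zero ∉ c (Fin.fromℕ p))
  ⊎ (IsTableau c × ¬ ∃ (λ k → InAllColumns c k))

IsLeastCommon : ∀ {n ℓ} → Elt n ℓ → Fin n → Set
IsLeastCommon c k0 = InAllColumns c k0 × (∀ k → InAllColumns c k → k0 Fin.≤ k)

-- red(b) given k0: delete k0 from every column and renumber entries k > k0 to k-1.
-- Entry i of the new column is present iff the old entry punchIn k0 i is present,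
-- where punchIn k0 i = i if i < k0 and i+1 otherwise.
red : ∀ {m ℓ} → Fin (suc m) → Elt (suc m) ℓ → Elt m ℓ
red k0 c j = Data.Vec.tabulate (λ i → Data.Vec.lookup (c j) (punchIn k0 i))
  where import Data.Vec

deleteLeftmostFull : ∀ {ℓ} → List (Subset ℓ) → List (Subset ℓ)
deleteLeftmostFull [] = []
deleteLeftmostFull (d ∷ ds) with ≡-dec BoolP._≟_ d S.⊤
... | yes _ = ds
... | no  _ = d ∷ deleteLeftmostFull ds

-- Under duality, j ∈ d_i iff i ∈ c_j. Hence ∣d_i∣ is the number of entries i of b, ℓ ∈ d_1 iff
-- 1 ∈ c_ℓ, d_i is full iff i lies in every column, and reduction deletes the factor d_{k₀}, which
-- is the leftmost full one. For the tableau condition: after reading d_1 ⋯ d_t the word of b*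
-- contains the letter j exactly ∣c_j ∩ {1,…,t}∣ times, and the letters inside one factor increase,
-- so the word is Yamanouchi iff for all t and j the column c_{j+1} has at most as many entries
-- ≤ t as c_j; for adjacent columns of sets this is exactly the semistandard row condition.
module Submission where

open import Defs
open import Data.Bool using (Bool; true; false; if_then_else_)
import Data.Bool.Properties as Boolₚ
open import Data.Empty using (⊥; ⊥-elim)
open import Data.Fin as Fin using (Fin; zero; suc; toℕ; fromℕ; punchIn)
import Data.Fin.Properties as Finₚ
open import Data.Fin.Subset using (Subset; ∣_∣; _∈_; _∉_; ⊤; inside; outside)
open import Data.Fin.Subset.Properties using (_∈?_; ∈⊤; ⊆⊤; ⊆-antisym)
open import Data.List as List using (List; []; _∷_; _++_; map; filter; length)
import Data.List.Properties as Listₚ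
open import Data.List.Relation.Unary.All as All using (All; []; _∷_)
import Data.List.Relation.Unary.All.Properties as Allₚ
open import Data.List.Relation.Unary.AllPairs as AllPairs using (AllPairs; []; _∷_)
import Data.List.Relation.Unary.AllPairs.Properties as AllPairsₚ
open import Data.List.Relation.Unary.Linked as Linked using (Linked)
open import Data.Nat as ℕ using (ℕ; zero; suc; _+_; _≤_; _<_; _≥_; z≤n; s≤s)
import Data.Nat.Properties as ℕₚ
open import Data.Product using (_,_; _×_; proj₁; proj₂; ∃)
open import Data.Product.Function.NonDependent.Propositional using (_×-⇔_)
open import Data.Sum using (_⊎_)
open import Data.Sum.Function.Propositional using (_⊎-⇔_)
open import Data.Unit using (tt) renaming (⊤ to Unit)
open import Data.Vec as Vec using (Vec; []; _∷_; lookup)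
import Data.Vec.Properties as Vecₚ
open import Function using (_∘_)
open import Function.Bundles using (_⇔_; mk⇔; module Equivalence)
open import Function.Properties.Equivalence using ()
  renaming (refl to ⇔-refl; sym to ⇔-sym; trans to ⇔-trans)
open import Function.Properties.Inverse using (↔⇒⇔)
open import Function.Related.Propositional using (module EquationalReasoning)
open import Function.Related.TypeIsomorphisms using (¬-cong-⇔)
open import Relation.Binary.PropositionalEquality
open import Relation.Nullary using (¬_; does; yes; no)
open import Relation.Unary using (Pred; Decidable)

-- Duality

if-∈?≡lookup : ∀ {n} (i : Fin n) (p : Subset n) →
  (if does (i ∈? p) then inside else outside) ≡ lookup p i
if-∈?≡lookup zero    (true  ∷ p) = refl
if-∈?≡lookup zero    (false ∷ p) = refl
if-∈?≡lookup (suc i) (_ ∷ p)     = if-∈?≡lookup i p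

lookup-dualF : ∀ {n ℓ} (c : Elt n ℓ) i j → lookup (dualF c i) j ≡ lookup (c j) i
lookup-dualF c i j = trans (Vecₚ.lookup∘tabulate _ j) (if-∈?≡lookup i (c j))

∈-dualF⇔ : ∀ {n ℓ} (c : Elt n ℓ) i j → j ∈ dualF c i ⇔ i ∈ c j
∈-dualF⇔ c i j = begin
  j ∈ dualF c i                 ∼⟨ ↔⇒⇔ Vecₚ.[]=↔lookup ⟩
  lookup (dualF c i) j ≡ true   ≡⟨ cong (_≡ true) (lookup-dualF c i j) ⟩
  lookup (c j) i ≡ true         ∼⟨ ⇔-sym (↔⇒⇔ Vecₚ.[]=↔lookup) ⟩
  i ∈ c j                       ∎
  where open EquationalReasoning

dualF≡⊤⇔InAllColumns : ∀ {n ℓ} (c : Elt n ℓ) i → dualF c i ≡ ⊤ ⇔ InAllColumns c i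
dualF≡⊤⇔InAllColumns c i = mk⇔
  (λ full j → Equivalence.to (∈-dualF⇔ c i j) (subst (j ∈_) (sym full) ∈⊤))
  (λ inAll → ⊆-antisym ⊆⊤ (λ {j} _ → Equivalence.from (∈-dualF⇔ c i j) (inAll j)))

¬Common⇔dualF≢⊤ : ∀ {n ℓ} (c : Elt n ℓ) →
  (¬ ∃ (InAllColumns c)) ⇔ (∀ i → dualF c i ≢ ⊤)
¬Common⇔dualF≢⊤ c = mk⇔
  (λ noCommon i full → noCommon (i , Equivalence.to (dualF≡⊤⇔InAllColumns c i) full))
  (λ noFull (i , inAll) → noFull i (Equivalence.from (dualF≡⊤⇔InAllColumns c i) inAll))

-- Reduction

deleteLeftmostFull-tabulate : ∀ {m ℓ} (g : Fin (suc m) → Subset ℓ) k₀ → g k₀ ≡ ⊤ →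
  (∀ k → g k ≡ ⊤ → k₀ Fin.≤ k) →
  List.tabulate (g ∘ punchIn k₀) ≡ deleteLeftmostFull (List.tabulate g)
deleteLeftmostFull-tabulate g k₀ full least with Vecₚ.≡-dec Boolₚ._≟_ (g zero) ⊤
deleteLeftmostFull-tabulate g zero full least | yes _ = refl
deleteLeftmostFull-tabulate g (suc k₀) full least | yes g₀-full with () ← least zero g₀-full
deleteLeftmostFull-tabulate g zero full least | no g₀-not-full = ⊥-elim (g₀-not-full full)
deleteLeftmostFull-tabulate {suc m} g (suc k₀) full least | no _ =
  cong (g zero ∷_)
    (deleteLeftmostFull-tabulate (g ∘ suc) k₀ full (λ k e → ℕₚ.≤-pred (least (suc k) e)))

dualF-red : ∀ {m ℓ} k₀ (c : Elt (suc m) ℓ) i → dualF (red k₀ c) i ≡ dualF c (punchIn k₀ i)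
dualF-red k₀ c i = Vecₚ.tabulate-cong λ j → begin
  (if does (i ∈? red k₀ c j) then inside else outside)     ≡⟨ if-∈?≡lookup i (red k₀ c j) ⟩
  lookup (red k₀ c j) i                                    ≡⟨ Vecₚ.lookup∘tabulate _ i ⟩
  lookup (c j) (punchIn k₀ i)                              ≡⟨ if-∈?≡lookup (punchIn k₀ i) (c j) ⟨
  (if does (punchIn k₀ i ∈? c j) then inside else outside) ∎
  where open ≡-Reasoning

dual-red : ∀ {m ℓ} (c : Elt (suc m) ℓ) k₀ → IsLeastCommon c k₀ →
  dual (red k₀ c) ≡ deleteLeftmostFull (dual c)
dual-red c k₀ (inAll , least) = trans (Listₚ.tabulate-cong (dualF-red k₀ c))
  (deleteLeftmostFull-tabulate (dualF c) k₀ (from (dualF≡⊤⇔InAllColumns c k₀) inAll)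
    (λ k full → least k (to (dualF≡⊤⇔InAllColumns c k) full)))
  where open Equivalence

-- Dominant evaluation

Adjacent : ∀ {n r} → (Fin n → Fin n → Set r) → Set r
Adjacent P = ∀ j j' → toℕ j' ≡ suc (toℕ j) → P j j'

Adjacent-cong : ∀ {n r s} {P : Fin n → Fin n → Set r} {Q : Fin n → Fin n → Set s} →
  (∀ j j' → P j j' ⇔ Q j j') → Adjacent P ⇔ Adjacent Q
Adjacent-cong P⇔Q = mk⇔ (λ adjacent j j' e → Equivalence.to (P⇔Q j j') (adjacent j j' e))
                        (λ adjacent j j' e → Equivalence.from (P⇔Q j j') (adjacent j j' e))

⇔-×ˡ : ∀ {a b} {A : Set a} {B : Set b} → A → B ⇔ (A × B)
⇔-×ˡ a = mk⇔ (a ,_) proj₂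

module _ {a r} {A : Set a} {R : A → A → Set r} where

  Linked-tabulate⁻ : ∀ {n} (g : Fin n → A) →
    Linked R (List.tabulate g) → Adjacent (λ k k' → R (g k) (g k'))
  Linked-tabulate⁻ {suc (suc n)} g (r Linked.∷ _)    zero    (suc zero)    refl = r
  Linked-tabulate⁻ {suc (suc n)} g (_ Linked.∷ rest) (suc k) (suc k')      eq   =
    Linked-tabulate⁻ (g ∘ suc) rest k k' (ℕₚ.suc-injective eq)
  Linked-tabulate⁻ {suc (suc n)} g _                 zero    (suc (suc _)) ()
  Linked-tabulate⁻ {suc _}       g _                 zero    zero          ()
  Linked-tabulate⁻ {suc (suc n)} g _                 (suc k) zero          ()

  Linked-tabulate⁺ : ∀ {n} (g : Fin n → A) →
    Adjacent (λ k k' → R (g k) (g k')) → Linked R (List.tabulate g)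
  Linked-tabulate⁺ {zero}        g adj = Linked.[]
  Linked-tabulate⁺ {suc zero}    g adj = Linked.[-]
  Linked-tabulate⁺ {suc (suc n)} g adj =
    adj zero (suc zero) refl Linked.∷
    Linked-tabulate⁺ (g ∘ suc) (λ k k' eq → adj (suc k) (suc k') (cong suc eq))

  Linked-tabulate⇔ : ∀ {n} (g : Fin n → A) →
    Linked R (List.tabulate g) ⇔ Adjacent (λ k k' → R (g k) (g k'))
  Linked-tabulate⇔ g = mk⇔ (Linked-tabulate⁻ g) (Linked-tabulate⁺ g)

∣tabulate-indicator∣≡length-filter : ∀ {a p k} {A : Set a} {P : Pred A p}
  (P? : Decidable P) (h : Fin k → A) →
  ∣ Vec.tabulate (λ j → if does (P? (h j)) then inside else outside) ∣
    ≡ length (filter P? (List.tabulate h))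
∣tabulate-indicator∣≡length-filter {k = zero}  P? h = refl
∣tabulate-indicator∣≡length-filter {k = suc k} P? h with does (P? (h zero))
... | true  = cong suc (∣tabulate-indicator∣≡length-filter P? (h ∘ suc))
... | false = ∣tabulate-indicator∣≡length-filter P? (h ∘ suc)

∣dualF∣≡entries : ∀ {n ℓ} (c : Elt n ℓ) i → ∣ dualF c i ∣ ≡ entries c i
∣dualF∣≡entries c i = ∣tabulate-indicator∣≡length-filter (λ j → i ∈? c j) (λ j → j)

DominantEval⇔Linked≥ : ∀ {n ℓ} (c : Elt n ℓ) → DominantEval c ⇔ Linked _≥_ (map ∣_∣ (dual c))
DominantEval⇔Linked≥ c = begin
  DominantEval c                             ∼⟨ ⇔-sym (Linked-tabulate⇔ (entries c)) ⟩
  Linked _≥_ (List.tabulate (entries c))     ≡⟨ cong (Linked _≥_) sizes ⟩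
  Linked _≥_ (map ∣_∣ (dual c))              ∎
  where
  open EquationalReasoning
  sizes : List.tabulate (entries c) ≡ map ∣_∣ (dual c)
  sizes = sym (trans (Listₚ.map-tabulate (dualF c) ∣_∣) (Listₚ.tabulate-cong (∣dualF∣≡entries c)))

countL-++ : ∀ k a b → countL k (a ++ b) ≡ countL k a + countL k b
countL-++ k a b =
  trans (cong length (Listₚ.filter-++ (ℕ._≟ k) a b)) (Listₚ.length-++ (filter (ℕ._≟ k) a))

countL-here : ∀ k w → countL k (k ∷ w) ≡ suc (countL k w)
countL-here k w = cong length (Listₚ.filter-accept (ℕ._≟ k) refl)

countL-there : ∀ {x} k w → x ≢ k → countL k (x ∷ w) ≡ countL k w
countL-there k w x≢k = cong length (Listₚ.filter-reject (ℕ._≟ k) x≢k)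

countL-absent : ∀ {k w} → All (_≢ k) w → countL k w ≡ 0
countL-absent {k} absent = cong length (Listₚ.filter-none (ℕ._≟ k) absent)

countL-map-suc : ∀ k w → countL (suc k) (map suc w) ≡ countL k w
countL-map-suc k []      = refl
countL-map-suc k (x ∷ w) with x ℕ.≟ k
... | yes refl = begin
  countL (suc x) (suc x ∷ map suc w)   ≡⟨ countL-here (suc x) (map suc w) ⟩
  suc (countL (suc x) (map suc w))     ≡⟨ cong suc (countL-map-suc x w) ⟩
  suc (countL x w)                     ≡⟨ countL-here x w ⟨
  countL x (x ∷ w)                     ∎
  where open ≡-Reasoning
... | no x≢k = begin
  countL (suc k) (suc x ∷ map suc w)   ≡⟨ countL-there (suc k) (map suc w) (x≢k ∘ ℕₚ.suc-injective) ⟩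
  countL (suc k) (map suc w)           ≡⟨ countL-map-suc k w ⟩
  countL k w                           ≡⟨ countL-there k w x≢k ⟨
  countL k (x ∷ w)                     ∎
  where open ≡-Reasoning

countL-++-none : ∀ {k} b {s} → countL k s ≡ 0 → countL k (b ++ s) ≡ countL k b
countL-++-none {k} b {s} none = begin
  countL k (b ++ s)          ≡⟨ countL-++ k b s ⟩
  countL k b + countL k s    ≡⟨ cong (countL k b +_) none ⟩
  countL k b + 0             ≡⟨ ℕₚ.+-identityʳ _ ⟩
  countL k b                 ∎
  where open ≡-Reasoning

above⇒absent : ∀ {x y s} → All (x <_) s → y ≤ x → All (_≢ y) s
above⇒absent above y≤x = All.map (λ x<z → ℕₚ.>⇒≢ (ℕₚ.≤-<-trans y≤x x<z)) above

below⇒absent : ∀ {x y s} → All (_≤ x) s → x < y → All (_≢ y) s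
below⇒absent below x<y = All.map (λ z≤x → ℕₚ.<⇒≢ (ℕₚ.≤-<-trans z≤x x<y)) below

-- Ballot words

Ballot : List ℕ → Set
Ballot a = ∀ k → 1 ≤ k → countL (suc k) a ≤ countL k a

BallotFrom : List ℕ → List ℕ → Set
BallotFrom a []      = Ballot a
BallotFrom a (x ∷ w) = Ballot a × BallotFrom (a ++ x ∷ []) w

Ballot-[] : Ballot []
Ballot-[] _ _ = z≤n

prefixes-Ballot⇔BallotFrom : ∀ a w → (∀ p q → w ≡ p ++ q → Ballot (a ++ p)) ⇔ BallotFrom a w
prefixes-Ballot⇔BallotFrom a [] = mk⇔
  (λ prefixes → subst Ballot (Listₚ.++-identityʳ a) (prefixes [] [] refl))
  (λ { ballot [] _ refl → subst Ballot (sym (Listₚ.++-identityʳ a)) ballot })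
prefixes-Ballot⇔BallotFrom a (x ∷ w) = mk⇔
  (λ prefixes → subst Ballot (Listₚ.++-identityʳ a) (prefixes [] (x ∷ w) refl)
              , to (λ p q eq → subst Ballot (sym (assoc p)) (prefixes (x ∷ p) q (cong (x ∷_) eq))))
  λ { (ballot , _)    []      _ refl → subst Ballot (sym (Listₚ.++-identityʳ a)) ballot
    ; (_ , ballotFrom) (_ ∷ p) q refl → subst Ballot (assoc p) (from ballotFrom p q refl) }
  where
  open Equivalence (prefixes-Ballot⇔BallotFrom (a ++ x ∷ []) w)
  assoc : ∀ p → (a ++ x ∷ []) ++ p ≡ a ++ x ∷ p
  assoc = Listₚ.++-assoc a (x ∷ [])

Yamanouchi⇔BallotFrom[] : ∀ w → Yamanouchi w ⇔ BallotFrom [] w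
Yamanouchi⇔BallotFrom[] = prefixes-Ballot⇔BallotFrom []

BallotFrom⇒Ballot : ∀ a w → BallotFrom a w → Ballot a
BallotFrom⇒Ballot a []      ballot       = ballot
BallotFrom⇒Ballot a (x ∷ w) (ballot , _) = ballot

BallotFrom⇒Ballot-++ : ∀ a u → BallotFrom a u → Ballot (a ++ u)
BallotFrom⇒Ballot-++ a []      ballot         = subst Ballot (sym (Listₚ.++-identityʳ a)) ballot
BallotFrom⇒Ballot-++ a (x ∷ u) (_ , ballotFrom) =
  subst Ballot (Listₚ.++-assoc a (x ∷ []) u) (BallotFrom⇒Ballot-++ (a ++ x ∷ []) u ballotFrom)

BallotFrom-++ : ∀ a u w → BallotFrom a (u ++ w) ⇔ (BallotFrom a u × BallotFrom (a ++ u) w)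
BallotFrom-++ a [] w = mk⇔
  (λ ballotFrom → BallotFrom⇒Ballot a w ballotFrom
                , subst (λ b → BallotFrom b w) (sym (Listₚ.++-identityʳ a)) ballotFrom)
  (λ (_ , ballotFrom) → subst (λ b → BallotFrom b w) (Listₚ.++-identityʳ a) ballotFrom)
BallotFrom-++ a (x ∷ u) w = mk⇔
  (λ (ballot , ballotFrom) → let (u-part , w-part) = to ballotFrom in
     (ballot , u-part) , subst (λ b → BallotFrom b w) assoc w-part)
  (λ ((ballot , u-part) , w-part) →
     ballot , from (u-part , subst (λ b → BallotFrom b w) (sym assoc) w-part))
  where
  open Equivalence (BallotFrom-++ (a ++ x ∷ []) u w)
  assoc : (a ++ x ∷ []) ++ u ≡ a ++ x ∷ u
  assoc = Listₚ.++-assoc a (x ∷ []) u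

Ballot-snoc : ∀ a x {s} → All (x <_) s → Ballot a → Ballot (a ++ x ∷ s) → Ballot (a ++ x ∷ [])
Ballot-snoc a x {s} above ballot ballot-all k 1≤k with x ℕ.≟ suc k
... | yes refl = begin
  countL x b                ≡⟨ countL-++-none b (countL-absent (above⇒absent above ℕₚ.≤-refl)) ⟨
  countL x (b ++ s)         ≡⟨ cong (countL x) (Listₚ.++-assoc a (x ∷ []) s) ⟩
  countL x (a ++ x ∷ s)     ≤⟨ ballot-all k 1≤k ⟩
  countL k (a ++ x ∷ s)     ≡⟨ cong (countL k) (Listₚ.++-assoc a (x ∷ []) s) ⟨
  countL k (b ++ s)         ≡⟨ countL-++-none b (countL-absent (above⇒absent above (ℕₚ.n≤1+n k))) ⟩
  countL k b                ∎
  where open ℕₚ.≤-Reasoning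
        b = a ++ x ∷ []
... | no x≢1+k = begin
  countL (suc k) (a ++ x ∷ [])  ≡⟨ countL-++-none a (countL-absent (x≢1+k ∷ [])) ⟩
  countL (suc k) a              ≤⟨ ballot k 1≤k ⟩
  countL k a                    ≤⟨ ℕₚ.m≤m+n _ _ ⟩
  countL k a + countL k (x ∷ []) ≡⟨ countL-++ k a (x ∷ []) ⟨
  countL k (a ++ x ∷ [])        ∎
  where open ℕₚ.≤-Reasoning

BallotFrom-increasing : ∀ a s → AllPairs _<_ s → BallotFrom a s ⇔ (Ballot a × Ballot (a ++ s))
BallotFrom-increasing a [] _ = mk⇔
  (λ ballot → ballot , subst Ballot (sym (Listₚ.++-identityʳ a)) ballot)
  (λ (ballot , _) → ballot)
BallotFrom-increasing a (x ∷ s) (above ∷ increasing) = mk⇔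
  (λ (ballot , ballotFrom) → ballot , subst Ballot assoc (proj₂ (to ballotFrom)))
  (λ (ballot , ballot-all) → ballot ,
     from (Ballot-snoc a x above ballot ballot-all , subst Ballot (sym assoc) ballot-all))
  where
  open Equivalence (BallotFrom-increasing (a ++ x ∷ []) s increasing)
  assoc : (a ++ x ∷ []) ++ s ≡ a ++ x ∷ s
  assoc = Listₚ.++-assoc a (x ∷ []) s

bit : Bool → ℕ
bit true  = 1
bit false = 0

letters : ∀ {ℓ} → Subset ℓ → List ℕ
letters []          = []
letters (true ∷ d)  = 1 ∷ map suc (letters d)
letters (false ∷ d) = map suc (letters d)

filter-∈?-∷ : ∀ {k m} (h : Fin k → Fin m) b (d : Subset m) →
  filter (_∈? (b ∷ d)) (List.tabulate (suc ∘ h)) ≡ map suc (filter (_∈? d) (List.tabulate h))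
filter-∈?-∷ {zero}  h b d = refl
filter-∈?-∷ {suc k} h b d with does (h zero ∈? d)
... | true  = cong (suc (h zero) ∷_) (filter-∈?-∷ (h ∘ suc) b d)
... | false = filter-∈?-∷ (h ∘ suc) b d

elems-inside : ∀ {m} (d : Subset m) → elems (inside ∷ d) ≡ zero ∷ map suc (elems d)
elems-inside d = cong (zero ∷_) (filter-∈?-∷ (λ i → i) inside d)

elems-outside : ∀ {m} (d : Subset m) → elems (outside ∷ d) ≡ map suc (elems d)
elems-outside d = filter-∈?-∷ (λ i → i) outside d

letters-elems : ∀ {ℓ} (d : Subset ℓ) → map (suc ∘ toℕ) (elems d) ≡ letters d
letters-elems []          = refl
letters-elems (true ∷ d)  = begin
  map (suc ∘ toℕ) (elems (true ∷ d))          ≡⟨ cong (map (suc ∘ toℕ)) (elems-inside d) ⟩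
  1 ∷ map (suc ∘ toℕ) (map suc (elems d))     ≡⟨ cong (1 ∷_) (Listₚ.map-∘ (elems d)) ⟨
  1 ∷ map (ℕ.suc ∘ ℕ.suc ∘ toℕ) (elems d)     ≡⟨ cong (1 ∷_) (Listₚ.map-∘ (elems d)) ⟩
  1 ∷ map suc (map (suc ∘ toℕ) (elems d))     ≡⟨ cong (λ w → 1 ∷ map suc w) (letters-elems d) ⟩
  1 ∷ map suc (letters d)                     ∎
  where open ≡-Reasoning
letters-elems (false ∷ d) = begin
  map (suc ∘ toℕ) (elems (false ∷ d))         ≡⟨ cong (map (suc ∘ toℕ)) (elems-outside d) ⟩
  map (suc ∘ toℕ) (map suc (elems d))         ≡⟨ Listₚ.map-∘ (elems d) ⟨
  map (ℕ.suc ∘ ℕ.suc ∘ toℕ) (elems d)         ≡⟨ Listₚ.map-∘ (elems d) ⟩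
  map suc (map (suc ∘ toℕ) (elems d))         ≡⟨ cong (map suc) (letters-elems d) ⟩
  map suc (letters d)                         ∎
  where open ≡-Reasoning

map-suc-positive : ∀ w → All (0 <_) (map suc w)
map-suc-positive w = Allₚ.map⁺ (All.universal (λ _ → s≤s z≤n) w)

letters-positive : ∀ {ℓ} (d : Subset ℓ) → All (0 <_) (letters d)
letters-positive []          = []
letters-positive (true ∷ d)  = s≤s z≤n ∷ map-suc-positive (letters d)
letters-positive (false ∷ d) = map-suc-positive (letters d)

letters-bounded : ∀ {ℓ} (d : Subset ℓ) → All (_≤ ℓ) (letters d)
letters-bounded []          = []
letters-bounded (true ∷ d)  = s≤s z≤n ∷ Allₚ.map⁺ (All.map s≤s (letters-bounded d))
letters-bounded (false ∷ d) = Allₚ.map⁺ (All.map s≤s (letters-bounded d))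

letters-increasing : ∀ {ℓ} (d : Subset ℓ) → AllPairs _<_ (letters d)
letters-increasing []          = []
letters-increasing (true ∷ d)  =
  Allₚ.map⁺ (All.map s≤s (letters-positive d))
  ∷ AllPairsₚ.map⁺ (AllPairs.map s≤s (letters-increasing d))
letters-increasing (false ∷ d) = AllPairsₚ.map⁺ (AllPairs.map s≤s (letters-increasing d))

countL-letters : ∀ {ℓ} (d : Subset ℓ) j → countL (suc (toℕ j)) (letters d) ≡ bit (lookup d j)
countL-letters (true ∷ d) zero = begin
  countL 1 (1 ∷ map suc (letters d))   ≡⟨ countL-here 1 (map suc (letters d)) ⟩
  suc (countL 1 (map suc (letters d))) ≡⟨ cong suc (countL-map-suc 0 (letters d)) ⟩
  suc (countL 0 (letters d))           ≡⟨ cong suc (countL-absent (above⇒absent (letters-positive d) z≤n)) ⟩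
  1                                    ∎
  where open ≡-Reasoning
countL-letters (false ∷ d) zero =
  trans (countL-map-suc 0 (letters d)) (countL-absent (above⇒absent (letters-positive d) z≤n))
countL-letters (true ∷ d) (suc j) = begin
  countL (2 + toℕ j) (1 ∷ map suc (letters d)) ≡⟨ countL-there {x = 1} (2 + toℕ j) (map suc (letters d)) (λ ()) ⟩
  countL (2 + toℕ j) (map suc (letters d))     ≡⟨ countL-map-suc _ (letters d) ⟩
  countL (1 + toℕ j) (letters d)               ≡⟨ countL-letters d j ⟩
  bit (lookup d j)                             ∎
  where open ≡-Reasoning
countL-letters (false ∷ d) (suc j) = trans (countL-map-suc _ (letters d)) (countL-letters d j)

countL-letters-beyond : ∀ {ℓ k} (d : Subset ℓ) → ℓ < k → countL k (letters d) ≡ 0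
countL-letters-beyond d ℓ<k = countL-absent (below⇒absent (letters-bounded d) ℓ<k)

-- The word of the dual

occurrences : ∀ {ℓ} → List ℕ → Fin ℓ → ℕ
occurrences a j = countL (suc (toℕ j)) a

occurrences-++-letters : ∀ {ℓ} a (d : Subset ℓ) j →
  occurrences (a ++ letters d) j ≡ bit (lookup d j) + occurrences a j
occurrences-++-letters a d j = begin
  countL (suc (toℕ j)) (a ++ letters d)              ≡⟨ countL-++ _ a (letters d) ⟩
  occurrences a j + countL (suc (toℕ j)) (letters d) ≡⟨ cong (occurrences a j +_) (countL-letters d j) ⟩
  occurrences a j + bit (lookup d j)                 ≡⟨ ℕₚ.+-comm (occurrences a j) _ ⟩
  bit (lookup d j) + occurrences a j                 ∎
  where open ≡-Reasoning

Ballot⇔Adjacent : ∀ ℓ v → (∀ k → 1 ≤ k → ℓ ≤ k → countL (suc k) v ≤ countL k v) →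
  Ballot v ⇔ Adjacent {ℓ} (λ j j' → occurrences v j' ≤ occurrences v j)
Ballot⇔Adjacent ℓ v beyond = mk⇔
  (λ ballot j j' j'≡1+j →
     subst (λ t → countL (suc t) v ≤ occurrences v j) (sym j'≡1+j) (ballot (suc (toℕ j)) (s≤s z≤n)))
  from
  where
  from : Adjacent (λ j j' → occurrences v j' ≤ occurrences v j) → Ballot v
  from adjacent (suc k) 1≤k with suc k ℕ.<? ℓ
  ... | no  k+1≮ℓ = beyond (suc k) 1≤k (ℕₚ.≮⇒≥ k+1≮ℓ)
  ... | yes k+1<ℓ = subst₂ (λ t t' → countL (suc t') v ≤ countL (suc t) v) toℕ-j toℕ-j'
                      (adjacent j j' (trans toℕ-j' (cong suc (sym toℕ-j))))
    where
    j  = Fin.fromℕ< (ℕₚ.<-trans (ℕₚ.n<1+n k) k+1<ℓ)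
    j' = Fin.fromℕ< k+1<ℓ
    toℕ-j : toℕ j ≡ k
    toℕ-j = Finₚ.toℕ-fromℕ< _
    toℕ-j' : toℕ j' ≡ suc k
    toℕ-j' = Finₚ.toℕ-fromℕ< k+1<ℓ

Ballot-beyond-letters : ∀ {ℓ} a (d : Subset ℓ) → Ballot a →
  ∀ k → 1 ≤ k → ℓ ≤ k → countL (suc k) (a ++ letters d) ≤ countL k (a ++ letters d)
Ballot-beyond-letters a d ballot k 1≤k ℓ≤k = begin
  countL (suc k) (a ++ letters d)        ≡⟨ countL-++-none a (countL-letters-beyond d (s≤s ℓ≤k)) ⟩
  countL (suc k) a                       ≤⟨ ballot k 1≤k ⟩
  countL k a                             ≤⟨ ℕₚ.m≤m+n _ _ ⟩
  countL k a + countL k (letters d)      ≡⟨ countL-++ k a (letters d) ⟨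
  countL k (a ++ letters d)              ∎
  where open ℕₚ.≤-Reasoning

BallotFrom-letters⇔ : ∀ {ℓ} a (d : Subset ℓ) → BallotFrom a (letters d) ⇔
  (Ballot a × Adjacent (λ j j' → occurrences (a ++ letters d) j' ≤ occurrences (a ++ letters d) j))
BallotFrom-letters⇔ {ℓ} a d = mk⇔
  (λ ballotFrom → let (ballot , ballot') = to increasing ballotFrom in
     ballot , Equivalence.to (adjacent ballot) ballot')
  (λ (ballot , steps) → from increasing (ballot , Equivalence.from (adjacent ballot) steps))
  where
  open Equivalence using (to; from)
  increasing = BallotFrom-increasing a (letters d) (letters-increasing d)
  adjacent = λ ballot → Ballot⇔Adjacent ℓ (a ++ letters d) (Ballot-beyond-letters a d ballot)

-- Dominates u X w Y: w + ∣Y ∩ {0,…,t}∣ ≤ u + ∣X ∩ {0,…,t}∣ for every t.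
Dominates : ∀ {n} → ℕ → Subset n → ℕ → Subset n → Set
Dominates {zero}  u X w Y = Unit
Dominates {suc n} u X w Y = bit (Vec.head Y) + w ≤ bit (Vec.head X) + u
                          × Dominates (bit (Vec.head X) + u) (Vec.tail X) (bit (Vec.head Y) + w) (Vec.tail Y)

Adjacent-Dominates-unfold : ∀ {n ℓ} (X : Fin ℓ → Subset (suc n)) (u u' : Fin ℓ → ℕ) →
  (∀ j → u' j ≡ bit (Vec.head (X j)) + u j) →
  Adjacent (λ j j' → Dominates (u j) (X j) (u j') (X j')) ⇔
  (Adjacent (λ j j' → u' j' ≤ u' j)
   × Adjacent (λ j j' → Dominates (u' j) (Vec.tail (X j)) (u' j') (Vec.tail (X j'))))
Adjacent-Dominates-unfold X u u' u'≡ = mk⇔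
  (λ dominates → (λ j j' e → subst₂ _≤_ (sym (u'≡ j')) (sym (u'≡ j)) (proj₁ (dominates j j' e)))
               , (λ j j' e → subst₂ (D j j') (sym (u'≡ j)) (sym (u'≡ j')) (proj₂ (dominates j j' e))))
  (λ (steps , dominates') j j' e → subst₂ _≤_ (u'≡ j') (u'≡ j) (steps j j' e)
                                  , subst₂ (D j j') (u'≡ j) (u'≡ j') (dominates' j j' e))
  where
  D : ∀ j j' → ℕ → ℕ → Set
  D j j' v w = Dominates v (Vec.tail (X j)) w (Vec.tail (X j'))

lookup-zero : ∀ {a n} {A : Set a} (v : Vec A (suc n)) → lookup v zero ≡ Vec.head v
lookup-zero (_ ∷ _) = refl

lookup-suc : ∀ {a n} {A : Set a} (v : Vec A (suc n)) i → lookup v (suc i) ≡ lookup (Vec.tail v) i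
lookup-suc (_ ∷ _) _ = refl

dualF-suc : ∀ {n ℓ} (c : Elt (suc n) ℓ) i → dualF c (suc i) ≡ dualF (Vec.tail ∘ c) i
dualF-suc c i = Vecₚ.tabulate-cong λ j → begin
  (if does (suc i ∈? c j) then inside else outside)          ≡⟨ if-∈?≡lookup (suc i) (c j) ⟩
  lookup (c j) (suc i)                                      ≡⟨ lookup-suc (c j) i ⟩
  lookup (Vec.tail (c j)) i                                 ≡⟨ if-∈?≡lookup i (Vec.tail (c j)) ⟨
  (if does (i ∈? Vec.tail (c j)) then inside else outside)  ∎
  where open ≡-Reasoning

word-dual-suc : ∀ {n ℓ} (c : Elt (suc n) ℓ) →
  word (dual c) ≡ letters (dualF c zero) ++ word (dual (Vec.tail ∘ c))
word-dual-suc c = cong₂ _++_ (letters-elems (dualF c zero))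
  (cong word (Listₚ.tabulate-cong (dualF-suc c)))

BallotFrom-word-dual⇔ : ∀ {ℓ} n (c : Elt n ℓ) a → BallotFrom a (word (dual c)) ⇔
  (Ballot a × Adjacent (λ j j' → Dominates (occurrences a j) (c j) (occurrences a j') (c j')))
BallotFrom-word-dual⇔ zero c a = mk⇔ (λ ballot → ballot , λ _ _ _ → tt) proj₁
BallotFrom-word-dual⇔ (suc n) c a = mk⇔
  (λ ballotFrom →
    let (ballotFrom₀ , ballotFrom') = to split (subst (BallotFrom a) (word-dual-suc c) ballotFrom)
        (ballot , steps) = to first-row ballotFrom₀
        (_ , dominates') = to other-rows ballotFrom'
    in ballot , from unfold (steps , dominates'))
  (λ (ballot , dominates) →
    let (steps , dominates') = to unfold dominates
        ballotFrom₀ = from first-row (ballot , steps)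
        ballotFrom' = from other-rows (BallotFrom⇒Ballot-++ a (letters d₀) ballotFrom₀ , dominates')
    in subst (BallotFrom a) (sym (word-dual-suc c)) (from split (ballotFrom₀ , ballotFrom')))
  where
  open Equivalence using (to; from)
  d₀ = dualF c zero
  a' = a ++ letters d₀
  split      = BallotFrom-++ a (letters d₀) (word (dual (Vec.tail ∘ c)))
  first-row  = BallotFrom-letters⇔ a d₀
  other-rows = BallotFrom-word-dual⇔ n (Vec.tail ∘ c) a'
  unfold = Adjacent-Dominates-unfold c (occurrences a) (occurrences a') λ j →
    trans (occurrences-++-letters a d₀ j)
          (cong (λ b → bit b + occurrences a j) (trans (lookup-dualF c zero j) (lookup-zero (c j))))

-- Rows of a tableau

-- RowOK once e cells, smaller than every entry, are stacked on top of the left column.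
RowOKPadded : ∀ {m} → ℕ → List (Fin m) → List (Fin m) → Set
RowOKPadded e       xs       []       = Unit
RowOKPadded (suc e) xs       (y ∷ ys) = RowOKPadded e xs ys
RowOKPadded zero    []       (y ∷ ys) = ⊥
RowOKPadded zero    (x ∷ xs) (y ∷ ys) = x Fin.≤ y × RowOKPadded zero xs ys

RowOKPadded-zero : ∀ {m} (xs ys : List (Fin m)) → RowOKPadded 0 xs ys ⇔ RowOK xs ys
RowOKPadded-zero xs       []       = ⇔-refl
RowOKPadded-zero []       (y ∷ ys) = ⇔-refl
RowOKPadded-zero (x ∷ xs) (y ∷ ys) = ⇔-refl ×-⇔ RowOKPadded-zero xs ys

RowOKPadded-suc : ∀ {m} e (xs ys : List (Fin m)) →
  RowOKPadded e (map suc xs) (map suc ys) ⇔ RowOKPadded e xs ys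
RowOKPadded-suc e       xs       []       = ⇔-refl
RowOKPadded-suc (suc e) xs       (y ∷ ys) = RowOKPadded-suc e xs ys
RowOKPadded-suc zero    []       (y ∷ ys) = ⇔-refl
RowOKPadded-suc zero    (x ∷ xs) (y ∷ ys) = mk⇔ ℕₚ.≤-pred s≤s ×-⇔ RowOKPadded-suc zero xs ys

RowOKPadded-zeroˡ : ∀ {m} e (xs ys : List (Fin (suc m))) →
  RowOKPadded e (zero ∷ xs) ys ⇔ RowOKPadded (suc e) xs ys
RowOKPadded-zeroˡ e       xs []       = ⇔-refl
RowOKPadded-zeroˡ zero    xs (y ∷ ys) = mk⇔ proj₂ (z≤n ,_)
RowOKPadded-zeroˡ (suc e) xs (y ∷ ys) = RowOKPadded-zeroˡ e xs ys

RowOKPadded-zero-zero : ∀ {m} e (xs ys : List (Fin (suc m))) →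
  RowOKPadded e (zero ∷ xs) (zero ∷ ys) ⇔ RowOKPadded e xs ys
RowOKPadded-zero-zero zero    xs ys = mk⇔ proj₂ (z≤n ,_)
RowOKPadded-zero-zero (suc e) xs ys = RowOKPadded-zeroˡ e xs ys

¬RowOKPadded-zeroʳ : ∀ {m} (xs : List (Fin m)) ys → ¬ RowOKPadded 0 (map suc xs) (zero ∷ ys)
¬RowOKPadded-zeroʳ []       ys ()
¬RowOKPadded-zeroʳ (x ∷ xs) ys (() , _)

RowOKPadded⇔Dominates : ∀ {n} (X Y : Subset n) e w →
  RowOKPadded e (elems X) (elems Y) ⇔ Dominates (e + w) X w Y
RowOKPadded⇔Dominates []          []          e w = mk⇔ (λ _ → tt) (λ _ → tt)
RowOKPadded⇔Dominates (false ∷ X) (false ∷ Y) e w = begin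
  RowOKPadded e (elems (false ∷ X)) (elems (false ∷ Y))
    ≡⟨ cong₂ (RowOKPadded e) (elems-outside X) (elems-outside Y) ⟩
  RowOKPadded e (map suc (elems X)) (map suc (elems Y))
    ∼⟨ RowOKPadded-suc e (elems X) (elems Y) ⟩
  RowOKPadded e (elems X) (elems Y)
    ∼⟨ RowOKPadded⇔Dominates X Y e w ⟩
  Dominates (e + w) X w Y
    ∼⟨ ⇔-×ˡ (ℕₚ.m≤n+m w e) ⟩
  Dominates (e + w) (false ∷ X) w (false ∷ Y) ∎
  where open EquationalReasoning
RowOKPadded⇔Dominates (true ∷ X) (false ∷ Y) e w = begin
  RowOKPadded e (elems (true ∷ X)) (elems (false ∷ Y))
    ≡⟨ cong₂ (RowOKPadded e) (elems-inside X) (elems-outside Y) ⟩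
  RowOKPadded e (zero ∷ map suc (elems X)) (map suc (elems Y))
    ∼⟨ RowOKPadded-zeroˡ e (map suc (elems X)) (map suc (elems Y)) ⟩
  RowOKPadded (suc e) (map suc (elems X)) (map suc (elems Y))
    ∼⟨ RowOKPadded-suc (suc e) (elems X) (elems Y) ⟩
  RowOKPadded (suc e) (elems X) (elems Y)
    ∼⟨ RowOKPadded⇔Dominates X Y (suc e) w ⟩
  Dominates (suc e + w) X w Y
    ∼⟨ ⇔-×ˡ (ℕₚ.m≤n+m w (suc e)) ⟩
  Dominates (e + w) (true ∷ X) w (false ∷ Y) ∎
  where open EquationalReasoning
RowOKPadded⇔Dominates (false ∷ X) (true ∷ Y) zero w = mk⇔
  (λ rowOK → ⊥-elim (¬RowOKPadded-zeroʳ (elems X) _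
     (subst₂ (RowOKPadded 0) (elems-outside X) (elems-inside Y) rowOK)))
  (λ (1+w≤w , _) → ⊥-elim (ℕₚ.1+n≰n 1+w≤w))
RowOKPadded⇔Dominates (false ∷ X) (true ∷ Y) (suc e) w = begin
  RowOKPadded (suc e) (elems (false ∷ X)) (elems (true ∷ Y))
    ≡⟨ cong₂ (RowOKPadded (suc e)) (elems-outside X) (elems-inside Y) ⟩
  RowOKPadded e (map suc (elems X)) (map suc (elems Y))
    ∼⟨ RowOKPadded-suc e (elems X) (elems Y) ⟩
  RowOKPadded e (elems X) (elems Y)
    ∼⟨ RowOKPadded⇔Dominates X Y e (suc w) ⟩
  Dominates (e + suc w) X (suc w) Y
    ≡⟨ cong (λ u → Dominates u X (suc w) Y) (ℕₚ.+-suc e w) ⟩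
  Dominates (suc e + w) X (suc w) Y
    ∼⟨ ⇔-×ˡ (s≤s (ℕₚ.m≤n+m w e)) ⟩
  Dominates (suc e + w) (false ∷ X) w (true ∷ Y) ∎
  where open EquationalReasoning
RowOKPadded⇔Dominates (true ∷ X) (true ∷ Y) e w = begin
  RowOKPadded e (elems (true ∷ X)) (elems (true ∷ Y))
    ≡⟨ cong₂ (RowOKPadded e) (elems-inside X) (elems-inside Y) ⟩
  RowOKPadded e (zero ∷ map suc (elems X)) (zero ∷ map suc (elems Y))
    ∼⟨ RowOKPadded-zero-zero e (map suc (elems X)) (map suc (elems Y)) ⟩
  RowOKPadded e (map suc (elems X)) (map suc (elems Y))
    ∼⟨ RowOKPadded-suc e (elems X) (elems Y) ⟩
  RowOKPadded e (elems X) (elems Y)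
    ∼⟨ RowOKPadded⇔Dominates X Y e (suc w) ⟩
  Dominates (e + suc w) X (suc w) Y
    ≡⟨ cong (λ u → Dominates u X (suc w) Y) (ℕₚ.+-suc e w) ⟩
  Dominates (suc e + w) X (suc w) Y
    ∼⟨ ⇔-×ˡ (s≤s (ℕₚ.m≤n+m w e)) ⟩
  Dominates (e + w) (true ∷ X) w (true ∷ Y) ∎
  where open EquationalReasoning

IsTableau⇔Yamanouchi : ∀ {n ℓ} (c : Elt n ℓ) → IsTableau c ⇔ Yamanouchi (word (dual c))
IsTableau⇔Yamanouchi {n} c = begin
  IsTableau c                                                 ∼⟨ Adjacent-cong rows ⟩
  Adjacent (λ j j' → Dominates 0 (c j) 0 (c j'))              ∼⟨ ⇔-×ˡ Ballot-[] ⟩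
  (Ballot [] × Adjacent (λ j j' → Dominates 0 (c j) 0 (c j'))) ∼⟨ ⇔-sym (BallotFrom-word-dual⇔ n c []) ⟩
  BallotFrom [] (word (dual c))                               ∼⟨ ⇔-sym (Yamanouchi⇔BallotFrom[] _) ⟩
  Yamanouchi (word (dual c))                                  ∎
  where
  open EquationalReasoning
  rows : ∀ j j' → RowOK (elems (c j)) (elems (c j')) ⇔ Dominates 0 (c j) 0 (c j')
  rows j j' = ⇔-trans (⇔-sym (RowOKPadded-zero (elems (c j)) (elems (c j'))))
                      (RowOKPadded⇔Dominates (c j) (c j') 0 0)

proposition2p41 : (m p s : ℕ) → 2 ≤ suc m → 2 ≤ suc p →
    (c : Elt (suc m) (suc p)) → InF s c →
    (Authorised c ⇔
      ((Linked _≥_ (map ∣_∣ (dual c)) × fromℕ p ∉ dualF c zero)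
       ⊎ (Yamanouchi (word (dual c)) × (∀ i → dualF c i ≢ ⊤))))
    × (∀ k0 → IsLeastCommon c k0 → dual (red k0 c) ≡ deleteLeftmostFull (dual c))
proposition2p41 m p s _ _ c _ = authorised , dual-red c
  where
  authorised =  (DominantEval⇔Linked≥ c ×-⇔ ¬-cong-⇔ (⇔-sym (∈-dualF⇔ c zero (fromℕ p))))
            ⊎-⇔ (IsTableau⇔Yamanouchi c ×-⇔ ¬Common⇔dualF≢⊤ c)
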